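{- Let $(Q,\lhd)$ be a finite quandle and let $Q_1, Q_2 \subseteq Q$ be two $Q$-complemented subquandles. Then $Q_1 \cap Q_2$ is a $Q$-complemented subquandle of $Q$.
   Context: A quandle is a set $Q$ with a binary operation $\lhd$ such that (i) $a\lhd a=a$ for all $a\in Q$; (ii) for all $a,b\in Q$ there is a unique $c\in Q$ with $a=c\lhd b$; (iii) $(a\lhd b)\lhd c=(a\lhd c)\lhd(b\lhd c)$ for all $a,b,c\in Q$. A subquandle of $Q$ is a subset $X\subseteq Q$ which is itself a quandle under the restriction of $\lhd$. A subquandle $X$ is called $Q$-complemented if $Q\setminus X$ is also a subquandle of $Q$. -}

module Defs where

open import Data.Nat using (ℕ)
open import Data.Fin using (Fin)
open import Data.Fin.Subset using (Subset; _∈_; ∁)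
open import Data.Product using (Σ; _×_; _,_)
open import Relation.Binary.PropositionalEquality using (_≡_)

-- A quandle structure on a finite set, taken (up to bijection) to be Fin n.
record IsQuandle {n : ℕ} (_◁_ : Fin n → Fin n → Fin n) : Set where
  field
    idem  : ∀ a → a ◁ a ≡ a
    rdiv  : ∀ a b → Σ (Fin n) λ c → (a ≡ c ◁ b) × (∀ c' → a ≡ c' ◁ b → c' ≡ c)
    rdist : ∀ a b c → (a ◁ b) ◁ c ≡ (a ◁ c) ◁ (b ◁ c)

record FiniteQuandle : Set where
  field
    size      : ℕ
    _◁_       : Fin size → Fin size → Fin size
    isQuandle : IsQuandle _◁_

record IsSubquandle (Q : FiniteQuandle) (X : Subset (FiniteQuandle.size Q)) : Set where
  open FiniteQuandle Q
  field
    closed : ∀ a b → a ∈ X → b ∈ X → (a ◁ b) ∈ X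
    idem   : ∀ a → a ∈ X → a ◁ a ≡ a
    rdiv   : ∀ a b → a ∈ X → b ∈ X →
             Σ (Fin size) λ c → (c ∈ X) × (a ≡ c ◁ b)
               × (∀ c' → c' ∈ X → a ≡ c' ◁ b → c' ≡ c)
    rdist  : ∀ a b c → a ∈ X → b ∈ X → c ∈ X →
             (a ◁ b) ◁ c ≡ (a ◁ c) ◁ (b ◁ c)

record IsComplementedSubquandle (Q : FiniteQuandle) (X : Subset (FiniteQuandle.size Q)) : Set where
  field
    sub  : IsSubquandle Q X
    comp : IsSubquandle Q (∁ X)

{-# OPTIONS --safe #-}
module Submission where

open import Defs
open import Data.Fin.Subset using (Subset; _∩_; _∈_; _∉_; ∁)
open import Data.Fin.Subset.Properties
  using (_∈?_; x∈p⇒x∉∁p; x∈∁p⇒x∉p; x∉p⇒x∈∁p; x∈p∩q⁺; x∈p∩q⁻)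
open import Data.Empty using (⊥-elim)
open import Data.Product using (_,_; proj₁; proj₂)
open import Data.Sum using (_⊎_; inj₁; inj₂; swap)
open import Function.Bundles using (_⇔_; mk⇔; module Equivalence)
open import Relation.Nullary using (yes; no)
open import Relation.Binary.PropositionalEquality using (_≡_; refl; sym; trans; subst)

-- If X and Q \ X are both subquandles, then membership in X is invariant under
-- every right translation a ↦ a ◁ b.  Conversely every such invariant subset is
-- a subquandle (the solution c of a ≡ c ◁ b lies in X together with a), and
-- invariance is preserved by complements and intersections.

module _ (Q : FiniteQuandle) where
  open FiniteQuandle Q
  open IsQuandle isQuandle

  ◁-cancelʳ : ∀ a c b → a ◁ b ≡ c ◁ b → a ≡ c
  ◁-cancelʳ a c b e = trans (unique a refl) (sym (unique c e))
    where unique = proj₂ (proj₂ (rdiv (a ◁ b) b))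

  RightInvariant : Subset size → Set
  RightInvariant X = ∀ a b → (a ◁ b) ∈ X ⇔ a ∈ X

  -- Q = X ⊔ Y with X, Y subquandles.  For b ∈ Y and a ◁ b ∈ Y, right division
  -- inside Y yields c ∈ Y with a ◁ b ≡ c ◁ b, so a ≡ c ∈ Y.
  partition⇒◁-closed : {X Y : Subset size} →
    IsSubquandle Q X → IsSubquandle Q Y →
    (∀ x → x ∈ X ⊎ x ∈ Y) → (∀ {x} → x ∈ X → x ∉ Y) →
    ∀ a b → a ∈ X → (a ◁ b) ∈ X
  partition⇒◁-closed {X} {Y} SX SY cover disjoint a b a∈X with cover b
  ... | inj₁ b∈X = IsSubquandle.closed SX a b a∈X b∈X
  ... | inj₂ b∈Y with cover (a ◁ b)
  ...   | inj₁ ab∈X = ab∈X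
  ...   | inj₂ ab∈Y = ⊥-elim (disjoint a∈X (subst (_∈ Y) (sym a≡c) c∈Y))
    where
    division = IsSubquandle.rdiv SY (a ◁ b) b ab∈Y b∈Y
    c∈Y = proj₁ (proj₂ division)
    a≡c = ◁-cancelʳ a (proj₁ division) b (proj₁ (proj₂ (proj₂ division)))

  partition⇒rightInvariant : {X Y : Subset size} →
    IsSubquandle Q X → IsSubquandle Q Y →
    (∀ x → x ∈ X ⊎ x ∈ Y) → (∀ {x} → x ∈ X → x ∉ Y) →
    RightInvariant X
  partition⇒rightInvariant {X} {Y} SX SY cover disjoint a b =
    mk⇔ reflect (partition⇒◁-closed SX SY cover disjoint a b)
    where
    reflect : (a ◁ b) ∈ X → a ∈ X
    reflect ab∈X with cover a
    ... | inj₁ a∈X = a∈X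
    ... | inj₂ a∈Y = ⊥-elim (disjoint ab∈X
      (partition⇒◁-closed SY SX (λ x → swap (cover x)) (λ y∈Y y∈X → disjoint y∈X y∈Y) a b a∈Y))

  ∈⊎∈∁ : (X : Subset size) → ∀ x → x ∈ X ⊎ x ∈ ∁ X
  ∈⊎∈∁ X x with x ∈? X
  ... | yes x∈X = inj₁ x∈X
  ... | no x∉X = inj₂ (x∉p⇒x∈∁p x∉X)

  complemented⇒rightInvariant : {X : Subset size} →
    IsComplementedSubquandle Q X → RightInvariant X
  complemented⇒rightInvariant {X} H =
    partition⇒rightInvariant sub comp (∈⊎∈∁ X) x∈p⇒x∉∁p
    where open IsComplementedSubquandle H

  rightInvariant-∁ : {X : Subset size} → RightInvariant X → RightInvariant (∁ X)
  rightInvariant-∁ inv a b = mk⇔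
    (λ ab∈∁X → x∉p⇒x∈∁p λ a∈X → x∈∁p⇒x∉p ab∈∁X (from a∈X))
    (λ a∈∁X → x∉p⇒x∈∁p λ ab∈X → x∈∁p⇒x∉p a∈∁X (to ab∈X))
    where open Equivalence (inv a b)

  rightInvariant-∩ : {X Y : Subset size} →
    RightInvariant X → RightInvariant Y → RightInvariant (X ∩ Y)
  rightInvariant-∩ {X} {Y} invX invY a b = mk⇔
    (λ ab∈X∩Y → let (p , q) = x∈p∩q⁻ X Y ab∈X∩Y in x∈p∩q⁺ (toX p , toY q))
    (λ a∈X∩Y → let (p , q) = x∈p∩q⁻ X Y a∈X∩Y in x∈p∩q⁺ (fromX p , fromY q))
    where
    open Equivalence (invX a b) renaming (to to toX; from to fromX)
    open Equivalence (invY a b) renaming (to to toY; from to fromY)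

  rightInvariant⇒subquandle : {X : Subset size} →
    RightInvariant X → IsSubquandle Q X
  rightInvariant⇒subquandle {X} inv = record
    { closed = λ a b a∈X _ → Equivalence.from (inv a b) a∈X
    ; idem   = λ a _ → idem a
    ; rdiv   = λ a b a∈X _ →
        let (c , a≡c◁b , unique) = rdiv a b
        in c , Equivalence.to (inv c b) (subst (_∈ X) a≡c◁b a∈X) , a≡c◁b
             , λ c' _ → unique c'
    ; rdist  = λ a b c _ _ _ → rdist a b c
    }

  rightInvariant⇒complemented : {X : Subset size} →
    RightInvariant X → IsComplementedSubquandle Q X
  rightInvariant⇒complemented inv = record
    { sub  = rightInvariant⇒subquandle inv
    ; comp = rightInvariant⇒subquandle (rightInvariant-∁ inv)
    }

mainTheorem1 : (Q : FiniteQuandle) (Q₁ Q₂ : Subset (FiniteQuandle.size Q)) →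
    IsComplementedSubquandle Q Q₁ → IsComplementedSubquandle Q Q₂ →
    IsComplementedSubquandle Q (Q₁ ∩ Q₂)
mainTheorem1 Q Q₁ Q₂ H₁ H₂ =
  rightInvariant⇒complemented Q
    (rightInvariant-∩ Q (complemented⇒rightInvariant Q H₁) (complemented⇒rightInvariant Q H₂))
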